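{- Let $\tau, \eta \in P_n$ with $\tau \leq \eta$, and let $i \in \mathbb{Z}/2n\mathbb{Z}$ with $i \in A(\tau)$. Then $i \notin C(\eta)$.
   Context: Let $P_n$ be the set of perfect matchings of $2n$ points labeled $1,\ldots,2n$ in order around a circle (labels read modulo $2n$). Matchings are represented by lensless medial graphs (strand diagrams in the disk, each pair of the matching joined by a strand, any two strands crossing at most once). The partial order on $P_n$ is generated by the covers $\tau' \lessdot \tau$ whenever resolving one crossing (replacing it by one of its two non-crossing smoothings) in some lensless medial graph of $\tau$ yields a lensless medial graph of $\tau'$. For $\tau \in P_n$ and $i \in \mathbb{Z}/2n\mathbb{Z}$: $i \in A(\tau)$ if the strands with endpoints $i$ and $i+1$ are different and do not cross; $i \in B(\tau)$ if they are different and cross; $i \in C(\tau)$ if $i$ is matched with $i+1$ in $\tau$. -}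

module Defs where

open import Data.Nat using (ℕ; zero; suc; _*_; _<ᵇ_)
open import Data.Nat.DivMod using (_mod_)
open import Data.Fin using (Fin; toℕ)
open import Data.Bool using (Bool; true; false; _∧_; _∨_; _xor_; if_then_else_; T)
open import Data.List using (List; map; allFin)
open import Data.Nat.ListAction using (sum)
open import Data.Product using (Σ; _×_; ∃-syntax)
open import Relation.Binary.PropositionalEquality using (_≡_; _≢_)
open import Relation.Nullary using (¬_)

-- Points 1..2n on the circle are modelled by Fin (2 * n) (label k+1 ↦ k),
-- so Z/2nZ is Fin (2 * n) with cyclic successor `next`.
Pt : ℕ → Set
Pt n = Fin (2 * n)

next : ∀ {m} → Fin m → Fin m
next {suc k} i = suc (toℕ i) mod suc k

-- A perfect matching = fixed-point-free involution (i ↦ partner of i).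
record PM (n : ℕ) : Set where
  constructor pm
  field
    mate   : Pt n → Pt n
    invol  : ∀ x → mate (mate x) ≡ x
    nofix  : ∀ x → mate x ≢ x
open PM public

betweenB : ∀ {m} → Fin m → Fin m → Fin m → Bool
betweenB a x b = ((toℕ a <ᵇ toℕ x) ∧ (toℕ x <ᵇ toℕ b)) ∨ ((toℕ b <ᵇ toℕ x) ∧ (toℕ x <ᵇ toℕ a))

-- The strands of τ through a and through c cross (chords interleave).
-- In a lensless medial graph two strands cross (exactly once) iff their
-- endpoints interleave around the circle.
crossB : ∀ {n} → PM n → Pt n → Pt n → Bool
crossB τ a c = betweenB a c (mate τ a) xor betweenB a (mate τ c) (mate τ a)

Crosses : ∀ {n} → PM n → Pt n → Pt n → Set
Crosses τ a c = T (crossB τ a c)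

-- number of crossings of τ (= number of crossings in any lensless medial graph)
cr : ∀ {n} → PM n → ℕ
cr {n} τ = sum (map (λ x → sum (map (λ y → cnt x y) (allFin (2 * n)))) (allFin (2 * n)))
  where
  cnt : Pt n → Pt n → ℕ
  cnt x y = if (toℕ x <ᵇ toℕ y) ∧ (toℕ x <ᵇ toℕ (mate τ x)) ∧ (toℕ y <ᵇ toℕ (mate τ y)) ∧ crossB τ x y
            then 1 else 0

-- Cover τ' ⋖ τ : τ' arises from τ by resolving one crossing (of the strands
-- {a, τ a} and {c, τ c}) into the smoothing {a,c},{τ a, τ c} (the other
-- smoothing is obtained by choosing c := τ c), all other strands unchanged,
-- and the result is again lensless, i.e. the crossing number drops by exactly one.
_⋖_ : ∀ {n} → PM n → PM n → Set
_⋖_ {n} τ' τ = ∃[ a ] ∃[ c ]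
    ( Crosses τ a c
    × mate τ' a ≡ c
    × mate τ' (mate τ a) ≡ mate τ c
    × (∀ x → x ≢ a → x ≢ mate τ a → x ≢ c → x ≢ mate τ c → mate τ' x ≡ mate τ x)
    × suc (cr τ') ≡ cr τ )

-- The partial order generated by the covers (reflexive-transitive closure;
-- matchings are identified when their mate functions agree pointwise).
data _≤ₘ_ {n : ℕ} (τ : PM n) : PM n → Set where
  ≤-refl : ∀ {η} → (∀ x → mate τ x ≡ mate η x) → τ ≤ₘ η
  ≤-step : ∀ {ρ η} → τ ≤ₘ ρ → ρ ⋖ η → τ ≤ₘ η

InA : ∀ {n} → PM n → Pt n → Set
InA τ i = (next i ≢ i) × (next i ≢ mate τ i) × ¬ Crosses τ i (next i)

InB : ∀ {n} → PM n → Pt n → Set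
InB τ i = (next i ≢ i) × (next i ≢ mate τ i) × Crosses τ i (next i)

InC : ∀ {n} → PM n → Pt n → Set
InC τ i = mate τ i ≡ next i

-- A strand joining neighbouring points i and i+1 separates no two boundary
-- points, so it crosses no strand.  Resolving a crossing only rematches the
-- four endpoints of the two crossing strands, so it leaves such a strand in
-- place: C(η) ⊆ C(ρ) whenever ρ ⋖ η, hence C(η) ⊆ C(τ) whenever τ ≤ η.
-- But i ∈ A(τ) says in particular that i is not matched with i+1 in τ.
module Submission where

open import Defs
open import Data.Nat using (ℕ; suc; _*_; _<_; _≤_; _<ᵇ_; s≤s)
open import Data.Nat.Properties
  using (<ᵇ⇒<; <⇒<ᵇ; <-irrefl; <-trans; <-asym; <⇒≤; ≤⇒≯; ≤∧≢⇒<; m<n⇒m<1+n;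
         n<1+n; n≢0⇒n>0; m≤n⇒m<n∨m≡n)
open import Data.Nat.DivMod using (_%_; m%n<n; m<n⇒m%n≡m; n%n≡0)
open import Data.Fin using (Fin; toℕ; _≟_)
open import Data.Fin.Properties using (toℕ-injective; toℕ<n; toℕ-fromℕ<)
open import Data.Bool using (true; false; _xor_; T)
open import Data.Bool.Properties using (T-∧; T-∨)
open import Data.Unit using (tt)
open import Data.Empty using (⊥-elim)
open import Data.Product using (_×_; _,_)
open import Data.Product.Function.NonDependent.Propositional using (_×-⇔_)
open import Data.Sum using (_⊎_; inj₁; inj₂; swap)
open import Data.Sum.Function.Propositional using (_⊎-⇔_)
open import Function using (_∘_; const)
open import Function.Bundles using (_⇔_; mk⇔; Equivalence)
open import Function.Properties.Equivalence using () renaming (sym to ⇔-sym; trans to ⇔-trans)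
open import Relation.Nullary using (¬_; yes; no)
open import Relation.Binary.PropositionalEquality
  using (_≡_; _≢_; refl; sym; trans; cong; subst; ≢-sym)

Between : ℕ → ℕ → ℕ → Set
Between p x q = (p < x × x < q) ⊎ (q < x × x < p)

Between-comm : ∀ {p x q} → Between p x q ⇔ Between q x p
Between-comm = mk⇔ swap swap

¬Between-left : ∀ {p q} → ¬ Between p p q
¬Between-left (inj₁ (p<p , _)) = <-irrefl refl p<p
¬Between-left (inj₂ (_ , p<p)) = <-irrefl refl p<p

¬Between-right : ∀ {p q} → ¬ Between p q q
¬Between-right (inj₁ (_ , q<q)) = <-irrefl refl q<q
¬Between-right (inj₂ (q<q , _)) = <-irrefl refl q<q

¬Between-zero : ∀ {p q} → ¬ Between p 0 q
¬Between-zero (inj₁ (() , _))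
¬Between-zero (inj₂ (() , _))

¬Between-above : ∀ {p q r} → p ≤ r → q ≤ r → ¬ Between p r q
¬Between-above _   q≤r (inj₁ (_ , r<q)) = ≤⇒≯ q≤r r<q
¬Between-above p≤r _   (inj₂ (_ , r<p)) = ≤⇒≯ p≤r r<p

¬Between-suc : ∀ {p x} → ¬ Between p x (suc p)
¬Between-suc (inj₁ (p<x , s≤s x≤p)) = ≤⇒≯ x≤p p<x
¬Between-suc {p} (inj₂ (1+p<x , x<p)) = <-asym (<-trans (n<1+n p) 1+p<x) x<p

Between-wrap : ∀ {p x} → x < suc p → x ≢ p → x ≢ 0 → Between p x 0
Between-wrap (s≤s x≤p) x≢p x≢0 = inj₂ (n≢0⇒n>0 x≢0 , ≤∧≢⇒< x≤p x≢p)

data CyclicSuc : ℕ → ℕ → ℕ → Set where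
  step : ∀ {m p} → CyclicSuc m p (suc p)
  wrap : ∀ {p} → CyclicSuc (suc p) p 0

Neighbours : ℕ → ℕ → ℕ → Set
Neighbours m p q = CyclicSuc m p q ⊎ CyclicSuc m q p

suc-%-cyclicSuc : ∀ {k p} → p < suc k → CyclicSuc (suc k) p (suc p % suc k)
suc-%-cyclicSuc {p = p} p<1+k with m≤n⇒m<n∨m≡n p<1+k
... | inj₁ 1+p<1+k = subst (CyclicSuc _ p) (sym (m<n⇒m%n≡m 1+p<1+k)) step
... | inj₂ refl = subst (CyclicSuc (suc p) p) (sym (n%n≡0 (suc p))) wrap

next-cyclicSuc : ∀ {m} (x : Fin m) → CyclicSuc m (toℕ x) (toℕ (next x))
next-cyclicSuc {suc k} x rewrite toℕ-fromℕ< (m%n<n (suc (toℕ x)) (suc k)) =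
  suc-%-cyclicSuc (toℕ<n x)

cyclicSuc-chord-same-side : ∀ {m p q x y} → CyclicSuc m p q → x < m → y < m →
  x ≢ p → x ≢ q → y ≢ p → y ≢ q → Between p x q ⇔ Between p y q
cyclicSuc-chord-same-side step _ _ _ _ _ _ =
  mk⇔ (⊥-elim ∘ ¬Between-suc) (⊥-elim ∘ ¬Between-suc)
cyclicSuc-chord-same-side wrap x<m y<m x≢p x≢0 y≢p y≢0 =
  mk⇔ (const (Between-wrap y<m y≢p y≢0)) (const (Between-wrap x<m x≢p x≢0))

short-chord-same-side : ∀ {m p q x y} → Neighbours m p q → x < m → y < m →
  x ≢ p → x ≢ q → y ≢ p → y ≢ q → Between p x q ⇔ Between p y q
short-chord-same-side (inj₁ p→q) x<m y<m x≢p x≢q y≢p y≢q =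
  cyclicSuc-chord-same-side p→q x<m y<m x≢p x≢q y≢p y≢q
short-chord-same-side (inj₂ q→p) x<m y<m x≢p x≢q y≢p y≢q =
  ⇔-trans Between-comm
    (⇔-trans (cyclicSuc-chord-same-side q→p x<m y<m x≢q x≢p y≢q y≢p) Between-comm)

cyclicSuc-same-side : ∀ {m p q r s} → CyclicSuc m r s → p < m → q < m →
  p ≢ r → p ≢ s → q ≢ r → q ≢ s → Between p r q ⇔ Between p s q
cyclicSuc-same-side {p = p} {q} {r} step _ _ p≢r p≢1+r q≢r q≢1+r = mk⇔ to from
  where
  to : Between p r q → Between p (suc r) q
  to (inj₁ (p<r , r<q)) = inj₁ (m<n⇒m<1+n p<r , ≤∧≢⇒< r<q (≢-sym q≢1+r))
  to (inj₂ (q<r , r<p)) = inj₂ (m<n⇒m<1+n q<r , ≤∧≢⇒< r<p (≢-sym p≢1+r))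
  from : Between p (suc r) q → Between p r q
  from (inj₁ (s≤s p≤r , 1+r<q)) = inj₁ (≤∧≢⇒< p≤r p≢r , <⇒≤ 1+r<q)
  from (inj₂ (s≤s q≤r , 1+r<p)) = inj₂ (≤∧≢⇒< q≤r q≢r , <⇒≤ 1+r<p)
cyclicSuc-same-side wrap (s≤s p≤r) (s≤s q≤r) _ _ _ _ =
  mk⇔ (⊥-elim ∘ ¬Between-above p≤r q≤r) (⊥-elim ∘ ¬Between-zero)

neighbours-same-side : ∀ {m p q r s} → Neighbours m r s → p < m → q < m →
  p ≢ r → p ≢ s → q ≢ r → q ≢ s → Between p r q ⇔ Between p s q
neighbours-same-side (inj₁ r→s) p<m q<m p≢r p≢s q≢r q≢s =
  cyclicSuc-same-side r→s p<m q<m p≢r p≢s q≢r q≢s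
neighbours-same-side (inj₂ s→r) p<m q<m p≢r p≢s q≢r q≢s =
  ⇔-sym (cyclicSuc-same-side s→r p<m q<m p≢s p≢r q≢s q≢r)

T-<ᵇ : ∀ {m n} → T (m <ᵇ n) ⇔ m < n
T-<ᵇ = mk⇔ (<ᵇ⇒< _ _) <⇒<ᵇ

T-betweenB : ∀ {m} (a x b : Fin m) → T (betweenB a x b) ⇔ Between (toℕ a) (toℕ x) (toℕ b)
T-betweenB a x b =
  ⇔-trans T-∨ (⇔-trans T-∧ (T-<ᵇ ×-⇔ T-<ᵇ) ⊎-⇔ ⇔-trans T-∧ (T-<ᵇ ×-⇔ T-<ᵇ))

¬T-xor : ∀ {u v} → T u ⇔ T v → ¬ T (u xor v)
¬T-xor {true}  {false} u⇔v _ = Equivalence.to u⇔v tt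
¬T-xor {false} {true}  u⇔v _ = Equivalence.from u⇔v tt

toℕ-≢ : ∀ {m} {x y : Fin m} → x ≢ y → toℕ x ≢ toℕ y
toℕ-≢ x≢y = x≢y ∘ toℕ-injective

module _ {n : ℕ} (τ : PM n) where

  mate-injective : ∀ {x y} → mate τ x ≡ mate τ y → x ≡ y
  mate-injective {x} {y} e = trans (sym (invol τ x)) (trans (cong (mate τ) e) (invol τ y))

  mate-swap : ∀ {x y} → mate τ x ≡ y → mate τ y ≡ x
  mate-swap {x} refl = invol τ x

  same-side⇒¬Crosses : ∀ a c →
    Between (toℕ a) (toℕ c) (toℕ (mate τ a)) ⇔ Between (toℕ a) (toℕ (mate τ c)) (toℕ (mate τ a)) →
    ¬ Crosses τ a c
  same-side⇒¬Crosses a c same =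
    ¬T-xor (⇔-trans (T-betweenB a c (mate τ a))
             (⇔-trans same (⇔-sym (T-betweenB a (mate τ c) (mate τ a)))))

  ShortStrand : Pt n → Set
  ShortStrand a = mate τ a ≡ next a ⊎ a ≡ next (mate τ a)

  ShortStrand-mate : ∀ {a} → ShortStrand a → ShortStrand (mate τ a)
  ShortStrand-mate {a} (inj₁ e) = inj₂ (trans e (cong next (sym (invol τ a))))
  ShortStrand-mate {a} (inj₂ e) = inj₁ (trans (invol τ a) e)

  ShortStrand-of-mate : ∀ {a} → ShortStrand (mate τ a) → ShortStrand a
  ShortStrand-of-mate {a} = subst ShortStrand (invol τ a) ∘ ShortStrand-mate

  shortStrand-neighbours : ∀ {a} → ShortStrand a → Neighbours (2 * n) (toℕ a) (toℕ (mate τ a))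
  shortStrand-neighbours {a} (inj₁ e) =
    inj₁ (subst (CyclicSuc _ (toℕ a) ∘ toℕ) (sym e) (next-cyclicSuc a))
  shortStrand-neighbours {a} (inj₂ e) =
    inj₂ (subst (CyclicSuc _ (toℕ (mate τ a)) ∘ toℕ) (sym e) (next-cyclicSuc (mate τ a)))

  short-strand-crosses-nothing : ∀ {a} c → ShortStrand a → ¬ Crosses τ a c
  short-strand-crosses-nothing {a} c short with c ≟ a | c ≟ mate τ a
  ... | yes refl | _ = same-side⇒¬Crosses a c (mk⇔ (⊥-elim ∘ ¬Between-left) (⊥-elim ∘ ¬Between-right))
  ... | no _ | yes refl = same-side⇒¬Crosses a c
        (mk⇔ (⊥-elim ∘ ¬Between-right) (⊥-elim ∘ ¬Between-left ∘ subst Between-a (invol τ a)))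
    where
    Between-a : Pt n → Set
    Between-a x = Between (toℕ a) (toℕ x) (toℕ (mate τ a))
  ... | no c≢a | no c≢τa = same-side⇒¬Crosses a c
        (short-chord-same-side (shortStrand-neighbours short) (toℕ<n c) (toℕ<n (mate τ c))
          (toℕ-≢ c≢a) (toℕ-≢ c≢τa)
          (toℕ-≢ (c≢τa ∘ sym ∘ mate-swap)) (toℕ-≢ (c≢a ∘ mate-injective)))

  -- crossB τ a c is not syntactically symmetric in a and c, hence this
  -- second version with the short strand in the other argument.
  nothing-crosses-short-strand : ∀ a {c} → ShortStrand c → ¬ Crosses τ a c
  nothing-crosses-short-strand a {c} short with a ≟ c | a ≟ mate τ c
  ... | yes refl | _ = short-strand-crosses-nothing c short
  ... | no _ | yes refl = short-strand-crosses-nothing c (ShortStrand-mate short)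
  ... | no a≢c | no a≢τc = same-side⇒¬Crosses a c
        (neighbours-same-side (shortStrand-neighbours short) (toℕ<n a) (toℕ<n (mate τ a))
          (toℕ-≢ a≢c) (toℕ-≢ a≢τc)
          (toℕ-≢ (a≢τc ∘ sym ∘ mate-swap)) (toℕ-≢ (a≢c ∘ mate-injective)))

⋖-preserves-InC : ∀ {n} {ρ η : PM n} {i} → ρ ⋖ η → InC η i → InC ρ i
⋖-preserves-InC {η = η} {i} (a , c , crossing , _ , _ , unchanged , _) i∈C =
  trans (unchanged i i≢a i≢ηa i≢c i≢ηc) i∈C
  where
  short : ShortStrand η i
  short = inj₁ i∈C
  i≢a : i ≢ a
  i≢a refl = short-strand-crosses-nothing η c short crossing
  i≢ηa : i ≢ mate η a
  i≢ηa refl = short-strand-crosses-nothing η c (ShortStrand-of-mate η {a} short) crossing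
  i≢c : i ≢ c
  i≢c refl = nothing-crosses-short-strand η a short crossing
  i≢ηc : i ≢ mate η c
  i≢ηc refl = nothing-crosses-short-strand η a (ShortStrand-of-mate η {c} short) crossing

InC-downward-closed : ∀ {n} {τ η : PM n} {i} → τ ≤ₘ η → InC η i → InC τ i
InC-downward-closed {i = i} (≤-refl same) i∈C = trans (same i) i∈C
InC-downward-closed {η = η} {i} (≤-step {ρ} τ≤ρ ρ⋖η) i∈C =
  InC-downward-closed {i = i} τ≤ρ (⋖-preserves-InC {ρ = ρ} {η} {i} ρ⋖η i∈C)

lemma3p3 : (n : ℕ) (τ η : PM n) (i : Pt n) → τ ≤ₘ η → InA τ i → ¬ InC η i
lemma3p3 n τ η i τ≤η (_ , i+1≢τi , _) i∈C = i+1≢τi (sym (InC-downward-closed τ≤η i∈C))
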